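{- For any alternating parity tree automaton $\mathcal{A}$ that recognizes standard effect trees in $\mathbf{Tree}_{\Sigma'}$, there exists an alternating parity tree automaton $\mathcal{A}_p$ that recognizes the set $\{t_p \in \mathbf{Tree}_{\Sigma} \mid t \text{ is accepted by } \mathcal{A}\}$.
   Context: Fix a signature of algebraic operations $\sigma : \mathsf{B} \rightsquigarrow k$ (parameter of finite ground type $\mathsf{B}$, arity $k$), a finite set $\mathcal{V}$ of constant values, and a set $S$ of other possible tree constructors. Standard effect trees live in $\mathbf{Tree}_{\Sigma'}$ with $\Sigma' = \{\sigma_v : k \mid (\sigma : \mathsf{B} \rightsquigarrow k), v : \mathsf{B} \in \mathcal{V}\} \cup S$ (operations indexed by their parameter). Effect trees with a branch for parameters live in $\mathbf{Tree}_{\Sigma}$ with $\Sigma = \{\sigma : k+1 \mid (\sigma : \mathsf{B} \rightsquigarrow k)\} \cup \{v : 0 \mid v \in \mathcal{V}\} \cup S$. For $t \in \mathbf{Tree}_{\Sigma'}$, $t_p$ is obtained by replacing every node $\sigma_v(t^1,\dots,t^k)$ by $\sigma(v, t^1_p,\dots,t^k_p)$. Alternating parity tree automata $(\Sigma,Q,\delta,q_i,\Omega)$ have finite state set $Q$, transitions $\delta(q,f)$ given by positive Boolean formulas over pairs (child index, state), and acceptance via run-trees in which every infinite path satisfies the parity condition (maximal priority occurring infinitely often is even). -}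

module Defs where

open import Data.Nat using (ℕ; zero; suc; _≤_; _<_)
open import Data.Nat.Divisibility using (_∣_)
open import Data.Fin using (Fin; toℕ)
open import Data.Product using (Σ; Σ-syntax; ∃; ∃-syntax; _×_; _,_)
open import Data.Sum using (_⊎_; inj₁; inj₂)
open import Data.Unit using (⊤)
open import Data.Empty using (⊥)
open import Data.List using (List; []; _∷_; _++_; [_])
open import Relation.Binary.PropositionalEquality using (_≡_)
open import Relation.Binary.Definitions using (DecidableEquality)

record RankedAlphabet : Set₁ where
  field
    Sym : Set
    ar  : Sym → ℕ
open RankedAlphabet public

-- Positions are words over ℕ, read from the root (i ∷ p = go to child i,
-- then follow p).  Only the *valid* positions (see ValidPos) matter;
-- labels at other positions are irrelevant junk, and trees are compared
-- by _≈_ (equality of labels on valid positions).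
Tree : RankedAlphabet → Set
Tree A = List ℕ → Sym A

sub : {A : RankedAlphabet} → Tree A → ℕ → Tree A
sub t i p = t (i ∷ p)

ValidPos : {A : RankedAlphabet} → Tree A → List ℕ → Set
ValidPos t []      = ⊤
ValidPos {A} t (i ∷ p) = (i < ar A (t [])) × ValidPos {A} (sub {A} t i) p

_≈_ : {A : RankedAlphabet} → Tree A → Tree A → Set
_≈_ {A} s t = ∀ p → ValidPos {A} s p → s p ≡ t p

data PBF (X : Set) : Set where
  true false : PBF X
  atom       : X → PBF X
  _∧_ _∨_    : PBF X → PBF X → PBF X

_⊨_ : {X : Set} → (X → Set) → PBF X → Set
Y ⊨ true     = ⊤
Y ⊨ false    = ⊥
Y ⊨ atom x   = Y x
Y ⊨ (θ ∧ θ′) = (Y ⊨ θ) × (Y ⊨ θ′)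
Y ⊨ (θ ∨ θ′) = (Y ⊨ θ) ⊎ (Y ⊨ θ′)

record APT (A : RankedAlphabet) : Set where
  field
    nQ : ℕ
    δ  : Fin nQ → (f : Sym A) → PBF (Fin (ar A f) × Fin nQ)
    qi : Fin nQ
    Ω  : Fin nQ → ℕ
open APT public

-- Nodes of a run-tree are addressed by words over ℕ written
-- in REVERSE order: [] is the root and (j ∷ u) is the j-th child of u.
-- Node u has nk u children; node (j ∷ u) is labelled by
--   (input position inpos (j ∷ u) = inpos u ++ [dir (j ∷ u)], state st (j ∷ u)).
record RunData (nQ : ℕ) : Set where
  field
    nk  : List ℕ → ℕ
    dir : List ℕ → ℕ
    st  : List ℕ → Fin nQ
open RunData public

module _ {nQ : ℕ} (r : RunData nQ) where

  inpos : List ℕ → List ℕ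
  inpos []      = []
  inpos (j ∷ u) = inpos u ++ [ dir r (j ∷ u) ]

  RNode : List ℕ → Set
  RNode []      = ⊤
  RNode (j ∷ u) = RNode u × (j < nk r u)

  addr : (ℕ → ℕ) → ℕ → List ℕ
  addr π zero    = []
  addr π (suc n) = π n ∷ addr π n

  IsPath : (ℕ → ℕ) → Set
  IsPath π = ∀ n → π n < nk r (addr π n)

Parity : (ℕ → ℕ) → Set
Parity c = Σ[ m ∈ ℕ ] (2 ∣ m)
         × (∀ n → ∃[ k ] (n ≤ k × c k ≡ m))
         × (∃[ N ] ∀ k → N ≤ k → c k ≤ m)

module _ {A : RankedAlphabet} (M : APT A) (t : Tree A) where

  ChildLabels : (r : RunData (nQ M)) (u : List ℕ) →
                Fin (ar A (t (inpos r u))) × Fin (nQ M) → Set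
  ChildLabels r u (d , q) =
    ∃[ j ] (j < nk r u × dir r (j ∷ u) ≡ toℕ d × st r (j ∷ u) ≡ q)

  IsRun : RunData (nQ M) → Set
  IsRun r = st r [] ≡ qi M
          × (∀ u → RNode r u →
               (∀ j → j < nk r u → dir r (j ∷ u) < ar A (t (inpos r u)))
               × (ChildLabels r u ⊨ δ M (st r u) (t (inpos r u))))

  IsAccepting : RunData (nQ M) → Set
  IsAccepting r = ∀ π → IsPath r π → Parity (λ n → Ω M (st r (addr r π n)))

  Accepts : Set
  Accepts = Σ[ r ∈ RunData (nQ M) ] (IsRun r × IsAccepting r)

record EffectSignature : Set₁ where
  field
    Ground   : Set
    _≟G_     : DecidableEquality Ground
    Op       : Set
    param    : Op → Ground
    arity    : Op → ℕ
    nV       : ℕ                          -- finite set 𝒱 = Fin nV of constants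
    ty       : Fin nV → Ground
    S        : Set                        -- other tree constructors
    arS      : S → ℕ
open EffectSignature public

module _ (E : EffectSignature) where

  Σ′ : RankedAlphabet
  Sym Σ′ = (Σ[ σ ∈ Op E ] Σ[ v ∈ Fin (nV E) ] ty E v ≡ param E σ) ⊎ S E
  ar  Σ′ (inj₁ (σ , _)) = arity E σ
  ar  Σ′ (inj₂ s)       = arS E s

  Σp : RankedAlphabet
  Sym Σp = Op E ⊎ (Fin (nV E) ⊎ S E)
  ar  Σp (inj₁ σ)        = suc (arity E σ)
  ar  Σp (inj₂ (inj₁ v)) = zero
  ar  Σp (inj₂ (inj₂ s)) = arS E s

  symP : Sym Σ′ → Sym Σp
  symP (inj₁ (σ , _)) = inj₁ σ
  symP (inj₂ s)       = inj₂ (inj₂ s)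

  mutual
    -- t ↦ t_p : replace every σ_v(t¹,…,tᵏ) by σ(v, t¹_p,…,tᵏ_p)
    -- (the parameter leaf v becomes child 0, tⁱ_p becomes child i).
    toP : Tree Σ′ → Tree Σp
    toP t []      = symP (t [])
    toP t (i ∷ p) = toPc (t []) (sub {Σ′} t) i p

    toPc : Sym Σ′ → (ℕ → Tree Σ′) → ℕ → List ℕ → Sym Σp
    toPc (inj₁ (σ , v , _)) ch zero    p = inj₂ (inj₁ v)
    toPc (inj₁ (σ , v , _)) ch (suc i) p = toP (ch i) p
    toPc (inj₂ s)           ch i       p = toP (ch i) p

-- A_p reads the parameter of an operation node from the constant in child 0.  In a
-- simulating state q it guesses, at a node σ, a constant v of the parameter type, sends a
-- checker for v to child 0 and behaves like A in state q at σ_v on the remaining children.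
-- The initial state additionally launches, with priority 0, a shape checker that visits the
-- whole tree and rejects constants anywhere except as child 0 of an operation of matching
-- parameter type.  So an accepted tree decodes to some t with toP t ≈ s, and the simulating
-- part of the run is an accepting run of A on t; conversely a run of A on t, together with
-- the shape and parameter checks, is an accepting run of A_p on toP t.

module Submission where

open import Defs
open import Data.Product using (Σ; Σ-syntax; ∃; ∃-syntax; _×_; _,_; proj₁; proj₂)
open import Data.Sum using (_⊎_; inj₁; inj₂)
open import Data.Nat using (ℕ; zero; suc; _<_; _≤_; _+_; _∸_; z≤n; s≤s; _<?_; pred)
open import Data.Nat.Properties
  using (≤-refl; ≤-reflexive; ≤-trans; <-≤-trans; n≤1+n; m≤m+n; +-monoʳ-≤; +-monoʳ-<;
         m+n∸m≡n; ∸-monoˡ-<; ≮⇒≥; m+n≮m; n≮0)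
open import Data.Nat.Divisibility using (divides)
open import Data.Fin using (Fin; toℕ; splitAt; _↑ˡ_; _↑ʳ_; fromℕ<)
  renaming (zero to fzero; suc to fsuc)
import Data.Fin as F
open import Data.Fin.Properties using (splitAt-↑ˡ; splitAt-↑ʳ; toℕ<n; toℕ-fromℕ<)
open import Data.List using (List; []; _∷_; _++_; [_]; length; filter; upTo)
open import Data.List.Properties using (++-identityʳ; ++-assoc)
open import Data.List.Membership.Propositional using (_∈_)
open import Data.List.Membership.Propositional.Properties
  using (∈-filter⁺; ∈-filter⁻; ∈-upTo⁺; ∈-upTo⁻)
open import Data.List.Relation.Unary.Any using (here; there)
open import Data.Unit using (⊤; tt)
open import Data.Empty using (⊥; ⊥-elim)
open import Relation.Nullary using (Dec; yes; no; ¬_)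
open import Relation.Binary.PropositionalEquality hiding ([_])
open import Axiom.UniquenessOfIdentityProofs using (module Decidable⇒UIP)

mapᴾ : {X Y : Set} → (X → Y) → PBF X → PBF Y
mapᴾ g true     = true
mapᴾ g false    = false
mapᴾ g (atom x) = atom (g x)
mapᴾ g (θ ∧ θ′) = mapᴾ g θ ∧ mapᴾ g θ′
mapᴾ g (θ ∨ θ′) = mapᴾ g θ ∨ mapᴾ g θ′

⋁ : {X : Set} (n : ℕ) → (Fin n → PBF X) → PBF X
⋁ zero    θ = false
⋁ (suc n) θ = θ fzero ∨ ⋁ n (λ i → θ (fsuc i))

⋀ : {X : Set} (n : ℕ) → (Fin n → PBF X) → PBF X
⋀ zero    θ = true
⋀ (suc n) θ = θ fzero ∧ ⋀ n (λ i → θ (fsuc i))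

decᴾ : {X P : Set} → Dec P → PBF X
decᴾ (yes _) = true
decᴾ (no _)  = false

module _ {X : Set} where

  ⊨-mono : {Y Z : X → Set} → (∀ x → Y x → Z x) → ∀ θ → Y ⊨ θ → Z ⊨ θ
  ⊨-mono Y⊆Z true     _         = tt
  ⊨-mono Y⊆Z false    ()
  ⊨-mono Y⊆Z (atom x) y         = Y⊆Z x y
  ⊨-mono Y⊆Z (θ ∧ θ′) (h , h′)  = ⊨-mono Y⊆Z θ h , ⊨-mono Y⊆Z θ′ h′
  ⊨-mono Y⊆Z (θ ∨ θ′) (inj₁ h)  = inj₁ (⊨-mono Y⊆Z θ h)
  ⊨-mono Y⊆Z (θ ∨ θ′) (inj₂ h′) = inj₂ (⊨-mono Y⊆Z θ′ h′)

  ⊨-mapᴾ⁺ : {X′ : Set} {Y : X′ → Set} (g : X → X′) →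
            ∀ θ → (λ x → Y (g x)) ⊨ θ → Y ⊨ mapᴾ g θ
  ⊨-mapᴾ⁺ g true     _         = tt
  ⊨-mapᴾ⁺ g false    ()
  ⊨-mapᴾ⁺ g (atom x) y         = y
  ⊨-mapᴾ⁺ g (θ ∧ θ′) (h , h′)  = ⊨-mapᴾ⁺ g θ h , ⊨-mapᴾ⁺ g θ′ h′
  ⊨-mapᴾ⁺ g (θ ∨ θ′) (inj₁ h)  = inj₁ (⊨-mapᴾ⁺ g θ h)
  ⊨-mapᴾ⁺ g (θ ∨ θ′) (inj₂ h′) = inj₂ (⊨-mapᴾ⁺ g θ′ h′)

  ⊨-mapᴾ⁻ : {X′ : Set} {Y : X′ → Set} (g : X → X′) →
            ∀ θ → Y ⊨ mapᴾ g θ → (λ x → Y (g x)) ⊨ θ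
  ⊨-mapᴾ⁻ g true     _         = tt
  ⊨-mapᴾ⁻ g false    ()
  ⊨-mapᴾ⁻ g (atom x) y         = y
  ⊨-mapᴾ⁻ g (θ ∧ θ′) (h , h′)  = ⊨-mapᴾ⁻ g θ h , ⊨-mapᴾ⁻ g θ′ h′
  ⊨-mapᴾ⁻ g (θ ∨ θ′) (inj₁ h)  = inj₁ (⊨-mapᴾ⁻ g θ h)
  ⊨-mapᴾ⁻ g (θ ∨ θ′) (inj₂ h′) = inj₂ (⊨-mapᴾ⁻ g θ′ h′)

  ⊨-⋁⁺ : {Y : X → Set} (n : ℕ) (θ : Fin n → PBF X) (i : Fin n) → Y ⊨ θ i → Y ⊨ ⋁ n θ
  ⊨-⋁⁺ (suc n) θ fzero    h = inj₁ h
  ⊨-⋁⁺ (suc n) θ (fsuc i) h = inj₂ (⊨-⋁⁺ n (λ i → θ (fsuc i)) i h)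

  ⊨-⋁⁻ : {Y : X → Set} (n : ℕ) (θ : Fin n → PBF X) → Y ⊨ ⋁ n θ → ∃[ i ] (Y ⊨ θ i)
  ⊨-⋁⁻ (suc n) θ (inj₁ h) = fzero , h
  ⊨-⋁⁻ (suc n) θ (inj₂ h) with i , h′ ← ⊨-⋁⁻ n (λ i → θ (fsuc i)) h = fsuc i , h′

  ⊨-⋀⁺ : {Y : X → Set} (n : ℕ) (θ : Fin n → PBF X) → (∀ i → Y ⊨ θ i) → Y ⊨ ⋀ n θ
  ⊨-⋀⁺ zero    θ h = tt
  ⊨-⋀⁺ (suc n) θ h = h fzero , ⊨-⋀⁺ n (λ i → θ (fsuc i)) (λ i → h (fsuc i))

  ⊨-⋀⁻ : {Y : X → Set} (n : ℕ) (θ : Fin n → PBF X) → Y ⊨ ⋀ n θ → ∀ i → Y ⊨ θ i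
  ⊨-⋀⁻ (suc n) θ (h , _) fzero    = h
  ⊨-⋀⁻ (suc n) θ (_ , h) (fsuc i) = ⊨-⋀⁻ n (λ i → θ (fsuc i)) h i

-- The default 0 is junk: nth is only used at indices below the length.
nth : List ℕ → ℕ → ℕ
nth []       _       = 0
nth (x ∷ xs) zero    = x
nth (x ∷ xs) (suc i) = nth xs i

nth-∈ : ∀ xs i → i < length xs → nth xs i ∈ xs
nth-∈ (x ∷ xs) zero    _       = here refl
nth-∈ (x ∷ xs) (suc i) (s≤s i<) = there (nth-∈ xs i i<)

∈⇒nth : ∀ {xs x} → x ∈ xs → ∃[ i ] (i < length xs × nth xs i ≡ x)
∈⇒nth (here refl) = 0 , s≤s z≤n , refl
∈⇒nth (there x∈)  = let i , i< , eq = ∈⇒nth x∈ in suc i , s≤s i< , eq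

pred-< : ∀ {d k} → d < suc k → d ≢ 0 → pred d < k
pred-< {zero}  _        d≢0 = ⊥-elim (d≢0 refl)
pred-< {suc d} (s≤s d<) _   = d<

module _ {B : RankedAlphabet} where

  ValidPos-++[] : (t : Tree B) (p : List ℕ) (d : ℕ) →
                  ValidPos {B} t p → d < ar B (t p) → ValidPos {B} t (p ++ [ d ])
  ValidPos-++[] t []      d _          d< = d< , tt
  ValidPos-++[] t (i ∷ p) d (i< , vp) d< = i< , ValidPos-++[] (sub {B} t i) p d vp d<

  ValidPos-++[]⁻ : (t : Tree B) (p : List ℕ) (d : ℕ) →
                   ValidPos {B} t (p ++ [ d ]) → ValidPos {B} t p × d < ar B (t p)
  ValidPos-++[]⁻ t []      d (d< , _) = tt , d<
  ValidPos-++[]⁻ t (i ∷ p) d (i< , vp) =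
    let vp′ , d< = ValidPos-++[]⁻ (sub {B} t i) p d vp in (i< , vp′) , d<

  ValidPos-++⁻ˡ : (t : Tree B) (p q : List ℕ) → ValidPos {B} t (p ++ q) → ValidPos {B} t p
  ValidPos-++⁻ˡ t []      q _          = tt
  ValidPos-++⁻ˡ t (i ∷ p) q (i< , vp) = i< , ValidPos-++⁻ˡ (sub {B} t i) p q vp

ChildLabelsⁿ : {m : ℕ} (n : ℕ) (r : RunData m) (u : List ℕ) → Fin n × Fin m → Set
ChildLabelsⁿ n r u (d , q) = ∃[ j ] (j < nk r u × dir r (j ∷ u) ≡ toℕ d × st r (j ∷ u) ≡ q)

RunStep : {B : RankedAlphabet} (M : APT B) (r : RunData (nQ M)) (u : List ℕ) (f : Sym B) → Set
RunStep {B} M r u f = (∀ j → j < nk r u → dir r (j ∷ u) < ar B f)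
                    × (ChildLabelsⁿ (ar B f) r u ⊨ δ M (st r u) f)

addr-irrelevant : {m m′ : ℕ} (r : RunData m) (r′ : RunData m′) (π : ℕ → ℕ) (n : ℕ) →
                  addr r π n ≡ addr r′ π n
addr-irrelevant r r′ π zero    = refl
addr-irrelevant r r′ π (suc n) = cong (π n ∷_) (addr-irrelevant r r′ π n)

IsPath⇒RNode : {m : ℕ} (r : RunData m) (π : ℕ → ℕ) → IsPath r π → ∀ n → RNode r (addr r π n)
IsPath⇒RNode r π path zero    = tt
IsPath⇒RNode r π path (suc n) = IsPath⇒RNode r π path n , path n

Parity-resp-≗ : {c c′ : ℕ → ℕ} → c ≗ c′ → Parity c → Parity c′
Parity-resp-≗ c≗c′ (m , 2∣m , often , N , bounded) =
    m , 2∣m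
  , (λ n → let k , n≤k , ck≡m = often n in k , n≤k , trans (sym (c≗c′ k)) ck≡m)
  , N , (λ k N≤k → subst (_≤ m) (c≗c′ k) (bounded k N≤k))

Parity-tail-zero : {c : ℕ → ℕ} → (∀ n → c (suc n) ≡ 0) → Parity c
Parity-tail-zero c≡0 =
  0 , divides 0 refl , (λ n → suc n , n≤1+n n , c≡0 n) , 1 , λ { (suc k) _ → ≤-reflexive (c≡0 k) }

module _ {B : RankedAlphabet} (M : APT B) where

  IsRun⇒ValidPos : (t : Tree B) (r : RunData (nQ M)) → IsRun M t r →
                   ∀ u → RNode r u → ValidPos {B} t (inpos r u)
  IsRun⇒ValidPos t r R []      _          = tt
  IsRun⇒ValidPos t r R (j ∷ u) (ru , j<) =
    ValidPos-++[] t (inpos r u) (dir r (j ∷ u))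
      (IsRun⇒ValidPos t r R u ru) (proj₁ (proj₂ R u ru) j j<)

  Accepts-resp-≈ : (t t′ : Tree B) → _≈_ {B} t t′ → Accepts M t → Accepts M t′
  Accepts-resp-≈ t t′ t≈t′ (r , R@(root , step) , acc) =
      r
    , (root , λ u ru → subst (RunStep M r u) (t≈t′ _ (IsRun⇒ValidPos t r R u ru)) (step u ru))
    , acc

module Encoding (E : EffectSignature) where

  Symᵖ : Set
  Symᵖ = Sym (Σp E)

  Sym′ : Set
  Sym′ = Sym (Σ′ E)

  fits? : (v : Fin (nV E)) (σ : Op E) → Dec (ty E v ≡ param E σ)
  fits? v σ = _≟G_ E (ty E v) (param E σ)

  open Decidable⇒UIP (_≟G_ E) public using (≡-irrelevant)

  shiftᵖ : Symᵖ → ℕ → ℕ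
  shiftᵖ (inj₁ _) d = suc d
  shiftᵖ (inj₂ _) d = d

  posP : Tree (Σ′ E) → List ℕ → List ℕ
  posP t []      = []
  posP t (d ∷ p) = shiftᵖ (symP E (t [])) d ∷ posP (sub {Σ′ E} t d) p

  toPc-shiftᵖ : (a : Sym′) (ch : ℕ → Tree (Σ′ E)) (d : ℕ) (q : List ℕ) →
                toPc E a ch (shiftᵖ (symP E a) d) q ≡ toP E (ch d) q
  toPc-shiftᵖ (inj₁ _) ch d q = refl
  toPc-shiftᵖ (inj₂ _) ch d q = refl

  toP-posP : ∀ t p → toP E t (posP t p) ≡ symP E (t p)
  toP-posP t []      = refl
  toP-posP t (d ∷ p) =
    trans (toPc-shiftᵖ (t []) (sub {Σ′ E} t) d _) (toP-posP (sub {Σ′ E} t d) p)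

  toP-posP-param : ∀ t p σ v e → t p ≡ inj₁ (σ , v , e) →
                   toP E t (posP t p ++ [ 0 ]) ≡ inj₂ (inj₁ v)
  toP-posP-param t []      σ v e eq rewrite eq = refl
  toP-posP-param t (d ∷ p) σ v e eq =
    trans (toPc-shiftᵖ (t []) (sub {Σ′ E} t) d _) (toP-posP-param (sub {Σ′ E} t d) p σ v e eq)

  posP-++[] : ∀ t p d → posP t (p ++ [ d ]) ≡ posP t p ++ [ shiftᵖ (symP E (t p)) d ]
  posP-++[] t []      d = refl
  posP-++[] t (x ∷ p) d = cong (_ ∷_) (posP-++[] (sub {Σ′ E} t x) p d)

  -- Where position p of the tree decoded from s sits in s (it is posP t p when s = toP E t).
  posS : Tree (Σp E) → List ℕ → List ℕ
  posS s []      = []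
  posS s (d ∷ p) = shiftᵖ (s []) d ∷ posS (sub {Σp E} s (shiftᵖ (s []) d)) p

  posS-++[] : ∀ s p d → posS s (p ++ [ d ]) ≡ posS s p ++ [ shiftᵖ (s (posS s p)) d ]
  posS-++[] s []      d = refl
  posS-++[] s (x ∷ p) d = cong (_ ∷_) (posS-++[] (sub {Σp E} s (shiftᵖ (s []) x)) p d)

  WellShaped : Symᵖ → Symᵖ → Set
  WellShaped (inj₁ σ)        g = ∃[ v ] (ty E v ≡ param E σ × g ≡ inj₂ (inj₁ v))
  WellShaped (inj₂ (inj₁ _)) g = ⊥
  WellShaped (inj₂ (inj₂ _)) g = ⊤

  arityᵖ : Symᵖ → ℕ
  arityᵖ (inj₁ σ)         = arity E σ
  arityᵖ (inj₂ (inj₁ _))  = 0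
  arityᵖ (inj₂ (inj₂ s))  = arS E s

  unshift : Symᵖ → ℕ → ℕ
  unshift (inj₁ _) d = pred d
  unshift (inj₂ _) d = d

  shiftᵖ-unshift : ∀ f g → WellShaped f g → ∀ d → (∀ v → g ≡ inj₂ (inj₁ v) → d ≢ 0) →
                   shiftᵖ f (unshift f d) ≡ d
  shiftᵖ-unshift (inj₁ σ)        g (v , _ , g≡v) zero    d≢0 = ⊥-elim (d≢0 v g≡v refl)
  shiftᵖ-unshift (inj₁ σ)        g _             (suc d) _   = refl
  shiftᵖ-unshift (inj₂ (inj₂ _)) g _             d       _   = refl

  Encodes : Sym′ → Symᵖ → Symᵖ → Set
  Encodes a f g = symP E a ≡ f × (∀ σ v e → a ≡ inj₁ (σ , v , e) → g ≡ inj₂ (inj₁ v))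

  -- Sym′ may be empty, so decoding junk needs a default symbol.
  module Decode (default : Sym′) where

    decodeOp : (σ : Op E) (v : Fin (nV E)) → Dec (ty E v ≡ param E σ) → Sym′
    decodeOp σ v (yes e) = inj₁ (σ , v , e)
    decodeOp σ v (no _)  = default

    decode : Symᵖ → Symᵖ → Sym′
    decode (inj₁ σ)        (inj₂ (inj₁ v)) = decodeOp σ v (fits? v σ)
    decode (inj₁ σ)        _               = default
    decode (inj₂ (inj₁ _)) g               = default
    decode (inj₂ (inj₂ s)) g               = inj₂ s

    decode-Encodes : ∀ f g → WellShaped f g → Encodes (decode f g) f g
    decode-Encodes (inj₁ σ) .(inj₂ (inj₁ v)) (v , e , refl) with fits? v σ
    ... | yes _ = refl , λ { _ _ _ refl → refl }
    ... | no ¬e = ⊥-elim (¬e e)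
    decode-Encodes (inj₂ (inj₂ s)) g tt = refl , λ { _ _ _ () }

    ar-decode : ∀ f g → WellShaped f g → ar (Σ′ E) (decode f g) ≡ arityᵖ f
    ar-decode (inj₁ σ) .(inj₂ (inj₁ v)) (v , e , refl) with fits? v σ
    ... | yes _ = refl
    ... | no ¬e = ⊥-elim (¬e e)
    ar-decode (inj₂ (inj₂ s)) g tt = refl

  ShapedLike : Tree (Σ′ E) → Tree (Σp E) → Set
  ShapedLike t s = ∀ p → ValidPos {Σ′ E} t p → Encodes (t p) (s (posS s p)) (s (posS s p ++ [ 0 ]))

  mutual
    toP-≈ : ∀ t s → ShapedLike t s → _≈_ {Σp E} (toP E t) s
    toP-≈ t s H []      _          = proj₁ (H [] tt)
    toP-≈ t s H (i ∷ P) (i< , vP) =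
      toPc-≈ (t []) (sub {Σ′ E} t) s (H [] tt) (λ i′ i′< p vp → H (i′ ∷ p) (i′< , vp)) i P i< vP

    toPc-≈ : (a : Sym′) (ch : ℕ → Tree (Σ′ E)) (s : Tree (Σp E)) →
             Encodes a (s []) (s [ 0 ]) →
             (∀ i → i < ar (Σ′ E) a → ShapedLike (ch i) (sub {Σp E} s (shiftᵖ (s []) i))) →
             ∀ i P → i < ar (Σp E) (symP E a) → ValidPos {Σp E} (toPc E a ch i) P →
             toPc E a ch i P ≡ s (i ∷ P)
    toPc-≈ (inj₁ (σ , v , e)) ch s (_ , param) H zero    []      _        _        =
      sym (param σ v e refl)
    toPc-≈ (inj₁ (σ , v , e)) ch s _           H zero    (_ ∷ _) _        (() , _)
    toPc-≈ (inj₁ (σ , v , e)) ch s (root , _)  H (suc i) P       (s≤s i<) vP =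
      subst (λ f → toP E (ch i) P ≡ s (shiftᵖ f i ∷ P)) (sym root) (toP-≈ (ch i) _ (H i i<) P vP)
    toPc-≈ (inj₂ s₀)          ch s (root , _)  H i       P       i<       vP =
      subst (λ f → toP E (ch i) P ≡ s (shiftᵖ f i ∷ P)) (sym root) (toP-≈ (ch i) _ (H i i<) P vP)

module Construction (E : EffectSignature) (A : APT (Σ′ E)) where
  open Encoding E

  data Role : Set where
    simulate : Fin (nQ A) → Role
    start    : Role
    shape    : Role
    check    : Fin (nV E) → Role

  NP : ℕ
  NP = nQ A + suc (suc (nV E))

  ⌜_⌝ : Role → Fin NP
  ⌜ simulate q ⌝ = q ↑ˡ suc (suc (nV E))
  ⌜ start ⌝      = nQ A ↑ʳ fzero
  ⌜ shape ⌝      = nQ A ↑ʳ fsuc fzero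
  ⌜ check v ⌝    = nQ A ↑ʳ fsuc (fsuc v)

  roleOf : Fin (nQ A) ⊎ Fin (suc (suc (nV E))) → Role
  roleOf (inj₁ q)               = simulate q
  roleOf (inj₂ fzero)           = start
  roleOf (inj₂ (fsuc fzero))    = shape
  roleOf (inj₂ (fsuc (fsuc v))) = check v

  role : Fin NP → Role
  role x = roleOf (splitAt (nQ A) x)

  role-⌜⌝ : ∀ ρ → role ⌜ ρ ⌝ ≡ ρ
  role-⌜⌝ (simulate q) = cong roleOf (splitAt-↑ˡ (nQ A) q _)
  role-⌜⌝ start        = cong roleOf (splitAt-↑ʳ (nQ A) _ fzero)
  role-⌜⌝ shape        = cong roleOf (splitAt-↑ʳ (nQ A) _ (fsuc fzero))
  role-⌜⌝ (check v)    = cong roleOf (splitAt-↑ʳ (nQ A) _ (fsuc (fsuc v)))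

  Lab : Symᵖ → Set
  Lab f = Fin (ar (Σp E) f) × Fin NP

  asSim : {k k′ : ℕ} → (Fin k → Fin k′) → Fin k × Fin (nQ A) → Fin k′ × Fin NP
  asSim ι (d , q) = ι d , ⌜ simulate q ⌝

  withParam : (σ : Op E) (v : Fin (nV E)) → Dec (ty E v ≡ param E σ) →
              (ty E v ≡ param E σ → PBF (Lab (inj₁ σ))) → PBF (Lab (inj₁ σ))
  withParam σ v (yes e) θ = atom (fzero , ⌜ check v ⌝) ∧ θ e
  withParam σ v (no _)  θ = false

  δSim : Fin (nQ A) → (f : Symᵖ) → PBF (Lab f)
  δSim q (inj₁ σ)        = ⋁ (nV E) λ v → withParam σ v (fits? v σ) λ e →
                             mapᴾ (asSim fsuc) (δ A q (inj₁ (σ , v , e)))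
  δSim q (inj₂ (inj₁ _)) = false
  δSim q (inj₂ (inj₂ s)) = mapᴾ (asSim (λ d → d)) (δ A q (inj₂ s))

  δShape : (f : Symᵖ) → PBF (Lab f)
  δShape (inj₁ σ)        = ⋁ (nV E) λ v → withParam σ v (fits? v σ) λ _ →
                             ⋀ (arity E σ) λ i → atom (fsuc i , ⌜ shape ⌝)
  δShape (inj₂ (inj₁ _)) = false
  δShape (inj₂ (inj₂ s)) = ⋀ (arS E s) λ i → atom (i , ⌜ shape ⌝)

  δCheck : Fin (nV E) → (f : Symᵖ) → PBF (Lab f)
  δCheck v (inj₁ _)         = false
  δCheck v (inj₂ (inj₁ v′)) = decᴾ (v F.≟ v′)
  δCheck v (inj₂ (inj₂ _))  = false

  δRole : Role → (f : Symᵖ) → PBF (Lab f)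
  δRole (simulate q) f = δSim q f
  δRole start        f = δSim (qi A) f ∧ δShape f
  δRole shape        f = δShape f
  δRole (check v)    f = δCheck v f

  ΩRole : Role → ℕ
  ΩRole (simulate q) = Ω A q
  ΩRole start        = Ω A (qi A)
  ΩRole shape        = 0
  ΩRole (check _)    = 0

  simState : Role → Fin (nQ A)
  simState (simulate q) = q
  simState _            = qi A

  Simulating : Role → Set
  Simulating (simulate _) = ⊤
  Simulating start        = ⊤
  Simulating shape        = ⊥
  Simulating (check _)    = ⊥

  simulating? : ∀ ρ → Dec (Simulating ρ)
  simulating? (simulate _) = yes tt
  simulating? start        = yes tt
  simulating? shape        = no λ ()
  simulating? (check _)    = no λ ()

  δRole⇒δSim : ∀ ρ → Simulating ρ → ∀ f (Y : Lab f → Set) → Y ⊨ δRole ρ f → Y ⊨ δSim (simState ρ) f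
  δRole⇒δSim (simulate _) _ f Y h       = h
  δRole⇒δSim start        _ f Y (h , _) = h

  ΩRole-simulating : ∀ ρ → Simulating ρ → ΩRole ρ ≡ Ω A (simState ρ)
  ΩRole-simulating (simulate _) _ = refl
  ΩRole-simulating start        _ = refl

  Ap : APT (Σp E)
  Ap = record { nQ = NP ; δ = λ x → δRole (role x) ; qi = ⌜ start ⌝ ; Ω = λ x → ΩRole (role x) }

  δ-⌜⌝ : ∀ ρ f → δ Ap ⌜ ρ ⌝ f ≡ δRole ρ f
  δ-⌜⌝ ρ f = cong (λ ρ′ → δRole ρ′ f) (role-⌜⌝ ρ)

  Ω-⌜⌝ : ∀ ρ → Ω Ap ⌜ ρ ⌝ ≡ ΩRole ρ
  Ω-⌜⌝ ρ = cong ΩRole (role-⌜⌝ ρ)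

  module _ {σ : Op E} {Y : Lab (inj₁ σ) → Set} where

    ⊨-withParam⁺ : ∀ v (θ : ty E v ≡ param E σ → PBF (Lab (inj₁ σ))) (e : ty E v ≡ param E σ) →
                   Y (fzero , ⌜ check v ⌝) → Y ⊨ θ e → Y ⊨ withParam σ v (fits? v σ) θ
    ⊨-withParam⁺ v θ e y h with fits? v σ
    ... | yes e′ = y , subst (λ e″ → Y ⊨ θ e″) (≡-irrelevant e e′) h
    ... | no ¬e  = ¬e e

    ⊨-⋁withParam⁻ : (θ : ∀ v → ty E v ≡ param E σ → PBF (Lab (inj₁ σ))) →
                    Y ⊨ (⋁ (nV E) λ v → withParam σ v (fits? v σ) (θ v)) →
                    ∃[ v ] Σ[ e ∈ ty E v ≡ param E σ ] (Y (fzero , ⌜ check v ⌝) × Y ⊨ θ v e)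
    ⊨-⋁withParam⁻ θ h with v , h′ ← ⊨-⋁⁻ (nV E) _ h = v , extract (fits? v σ) h′
      where
        extract : ∀ {v} (d : Dec (ty E v ≡ param E σ)) → Y ⊨ withParam σ v d (θ v) →
                  Σ[ e ∈ ty E v ≡ param E σ ] (Y (fzero , ⌜ check v ⌝) × Y ⊨ θ v e)
        extract (yes e) (y , h) = e , y , h

  ⊨-δCheck-self : ∀ v (Y : Lab (inj₂ (inj₁ v)) → Set) → Y ⊨ δCheck v (inj₂ (inj₁ v))
  ⊨-δCheck-self v Y with v F.≟ v
  ... | yes _ = tt
  ... | no ¬r = ¬r refl

  ⊨-δCheck⁻ : ∀ v f (Y : Lab f → Set) → Y ⊨ δCheck v f → f ≡ inj₂ (inj₁ v)
  ⊨-δCheck⁻ v (inj₂ (inj₁ v′)) Y h with v F.≟ v′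
  ... | yes refl = refl

module Completeness (E : EffectSignature) (A : APT (Σ′ E)) (t : Tree (Σ′ E))
                    (r : RunData (nQ A)) (R : IsRun A t r) (acc : IsAccepting A t r) where
  open Encoding E
  open Construction E A

  lab : List ℕ → Sym′
  lab u = t (inpos r u)

  arᵖ : Sym′ → ℕ
  arᵖ a = ar (Σp E) (symP E a)

  paramCount : Sym′ → ℕ
  paramCount (inj₁ _) = 1
  paramCount (inj₂ _) = 0

  -- copy u mirrors node u of r; shapeAt p d checks the subtree of t at p (entered in
  -- direction d of toP E t); checkAt P v checks that toP E t has the constant v at P;
  -- dead is only reached through out-of-range child indices.
  data Node : Set where
    copy    : List ℕ → Node
    shapeAt : List ℕ → ℕ → Node
    checkAt : List ℕ → Fin (nV E) → Node
    dead    : Node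

  spawn : List ℕ → Sym′ → ℕ → Node
  spawn p (inj₁ (σ , v , e)) zero    = checkAt (posP t p ++ [ 0 ]) v
  spawn p (inj₁ _)           (suc i) = shapeAt (p ++ [ i ]) (suc i)
  spawn p (inj₂ _)           i       = shapeAt (p ++ [ i ]) i

  copyChild : (u : List ℕ) (j : ℕ) → Dec (j < nk r u) → Node
  copyChild u j (yes _) = copy (j ∷ u)
  copyChild u j (no _)  = spawn (inpos r u) (lab u) (j ∸ nk r u)

  degree : Node → ℕ
  degree (copy [])      = nk r [] + arᵖ (lab [])
  degree (copy (j ∷ u)) = nk r (j ∷ u) + paramCount (lab (j ∷ u))
  degree (shapeAt p _)  = arᵖ (t p)
  degree (checkAt _ _)  = 0
  degree dead           = 0

  child : Node → ℕ → Node
  child (copy u)      j = copyChild u j (j <? nk r u)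
  child (shapeAt p _) m = spawn p (t p) m
  child (checkAt _ _) _ = dead
  child dead          _ = dead

  direction : Node → ℕ
  direction (copy [])      = 0
  direction (copy (j ∷ u)) = shiftᵖ (symP E (lab u)) (dir r (j ∷ u))
  direction (shapeAt _ d)  = d
  direction (checkAt _ _)  = 0
  direction dead           = 0

  roleAt : Node → Role
  roleAt (copy [])      = start
  roleAt (copy (j ∷ u)) = simulate (st r (j ∷ u))
  roleAt (shapeAt _ _)  = shape
  roleAt (checkAt _ v)  = check v
  roleAt dead           = shape

  position : Node → List ℕ
  position (copy u)      = posP t (inpos r u)
  position (shapeAt p _) = posP t p
  position (checkAt P _) = P
  position dead          = []

  Valid : Node → Set
  Valid (copy u)      = RNode r u
  Valid (shapeAt _ _) = ⊤
  Valid (checkAt P v) = toP E t P ≡ inj₂ (inj₁ v)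
  Valid dead          = ⊥

  node : List ℕ → Node
  node []      = copy []
  node (j ∷ u) = child (node u) j

  run : RunData NP
  run = record { nk  = λ u → degree (node u)
               ; dir = λ u → direction (node u)
               ; st  = λ u → ⌜ roleAt (node u) ⌝ }

  child-copy-< : ∀ u j → j < nk r u → child (copy u) j ≡ copy (j ∷ u)
  child-copy-< u j j< with j <? nk r u
  ... | yes _ = refl
  ... | no j≮ = ⊥-elim (j≮ j<)

  child-copy-≮ : ∀ u j → ¬ j < nk r u → child (copy u) j ≡ spawn (inpos r u) (lab u) (j ∸ nk r u)
  child-copy-≮ u j j≮ with j <? nk r u
  ... | yes j< = ⊥-elim (j≮ j<)
  ... | no _   = refl

  child-copy-+ : ∀ u m → child (copy u) (nk r u + m) ≡ spawn (inpos r u) (lab u) m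
  child-copy-+ u m =
    trans (child-copy-≮ u _ (m+n≮m _ m)) (cong (spawn (inpos r u) (lab u)) (m+n∸m≡n (nk r u) m))

  paramCount≤arᵖ : ∀ a → paramCount a ≤ arᵖ a
  paramCount≤arᵖ (inj₁ _) = s≤s z≤n
  paramCount≤arᵖ (inj₂ _) = z≤n

  degree-copy-≤ : ∀ u → degree (copy u) ≤ nk r u + arᵖ (lab u)
  degree-copy-≤ []      = ≤-refl
  degree-copy-≤ (j ∷ u) = +-monoʳ-≤ (nk r (j ∷ u)) (paramCount≤arᵖ (lab (j ∷ u)))

  degree-copy-≥ : ∀ u → nk r u + paramCount (lab u) ≤ degree (copy u)
  degree-copy-≥ []      = +-monoʳ-≤ (nk r []) (paramCount≤arᵖ (lab []))
  degree-copy-≥ (j ∷ u) = ≤-refl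

  ∸-<-spawned : ∀ {j k} u → j < nk r u + k → ¬ j < nk r u → j ∸ nk r u < k
  ∸-<-spawned {j} {k} u j< j≮ =
    subst (j ∸ nk r u <_) (m+n∸m≡n (nk r u) k) (∸-monoˡ-< j< (≮⇒≥ j≮))

  spawn-valid : ∀ p a → t p ≡ a → ∀ m → m < arᵖ a →
                Valid (spawn p a m)
              × position (spawn p a m) ≡ posP t p ++ [ direction (spawn p a m) ]
  spawn-valid p (inj₁ (σ , v , e)) tp≡a zero    _ = toP-posP-param t p σ v e tp≡a , refl
  spawn-valid p (inj₁ (σ , v , e)) tp≡a (suc i) _ =
    tt , trans (posP-++[] t p i) (cong (λ a → posP t p ++ [ shiftᵖ (symP E a) i ]) tp≡a)
  spawn-valid p (inj₂ s)           tp≡a i       _ =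
    tt , trans (posP-++[] t p i) (cong (λ a → posP t p ++ [ shiftᵖ (symP E a) i ]) tp≡a)

  child-valid : ∀ n → Valid n → ∀ j → j < degree n →
                Valid (child n j) × position (child n j) ≡ position n ++ [ direction (child n j) ]
  child-valid (copy u) ru j j< with j <? nk r u
  ... | yes j<nk = (ru , j<nk) , posP-++[] t (inpos r u) (dir r (j ∷ u))
  ... | no j≮nk  = spawn-valid (inpos r u) (lab u) refl _
                     (∸-<-spawned u (≤-trans j< (degree-copy-≤ u)) j≮nk)
  child-valid (shapeAt p _) _ j j< = spawn-valid p (t p) refl j j<

  node-valid : ∀ u → RNode run u → Valid (node u) × inpos run u ≡ position (node u)
  node-valid []      _          = tt , refl
  node-valid (j ∷ u) (ru , j<) =
    let valid , u≡ = node-valid u ru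
        valid′ , j≡ = child-valid (node u) valid j j<
    in valid′ , trans (cong (_++ [ direction (node (j ∷ u)) ]) u≡) (sym j≡)

  ChildLabelsᴺ : (k : ℕ) → Node → Fin k × Fin NP → Set
  ChildLabelsᴺ k n (d , x) =
    ∃[ j ] (j < degree n × direction (child n j) ≡ toℕ d × ⌜ roleAt (child n j) ⌝ ≡ x)

  RunStepᴺ : Node → Symᵖ → Set
  RunStepᴺ n f = (∀ j → j < degree n → direction (child n j) < ar (Σp E) f)
               × (ChildLabelsᴺ (ar (Σp E) f) n ⊨ δRole (roleAt n) f)

  shiftᵖ-< : ∀ a d → d < ar (Σ′ E) a → shiftᵖ (symP E a) d < arᵖ a
  shiftᵖ-< (inj₁ _) d d< = s≤s d<
  shiftᵖ-< (inj₂ _) d d< = d<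

  spawn-direction< : ∀ p a m → m < arᵖ a → direction (spawn p a m) < arᵖ a
  spawn-direction< p (inj₁ _) zero    _  = s≤s z≤n
  spawn-direction< p (inj₁ _) (suc i) i< = i<
  spawn-direction< p (inj₂ _) i       i< = i<

  copy-directions : ∀ u → RNode r u → ∀ j → j < degree (copy u) →
                    direction (child (copy u) j) < arᵖ (lab u)
  copy-directions u ru j j< with j <? nk r u
  ... | yes j<nk = shiftᵖ-< (lab u) _ (proj₁ (proj₂ R u ru) j j<nk)
  ... | no j≮nk  = spawn-direction< (inpos r u) (lab u) _
                     (∸-<-spawned u (≤-trans j< (degree-copy-≤ u)) j≮nk)

  copy-embeds : ∀ u a → lab u ≡ a → {k : ℕ} (ι : Fin k → Fin (arᵖ a)) →
                (∀ d → toℕ (ι d) ≡ shiftᵖ (symP E a) (toℕ d)) →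
                ∀ x → ChildLabelsⁿ k r u x → ChildLabelsᴺ (arᵖ a) (copy u) (asSim ι x)
  copy-embeds u a lab≡a ι ι≡ (d , q) (j , j< , dj , sj) =
      j , <-≤-trans j< (≤-trans (m≤m+n _ _) (degree-copy-≥ u))
    , trans (cong direction (child-copy-< u j j<))
        (trans (cong (λ a → shiftᵖ (symP E a) (dir r (j ∷ u))) lab≡a)
          (trans (cong (shiftᵖ (symP E a)) dj) (sym (ι≡ d))))
    , trans (cong (λ n → ⌜ roleAt n ⌝) (child-copy-< u j j<)) (cong (λ q → ⌜ simulate q ⌝) sj)

  simulate-step : ∀ u a → lab u ≡ a → ChildLabelsⁿ (ar (Σ′ E) a) r u ⊨ δ A (st r u) a →
                  ChildLabelsᴺ (arᵖ a) (copy u) ⊨ δSim (st r u) (symP E a)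
  simulate-step u a@(inj₁ (σ , v , e)) lab≡a h =
    ⊨-⋁⁺ (nV E) _ v (⊨-withParam⁺ v _ e param-child
      (⊨-mapᴾ⁺ (asSim fsuc) θ (⊨-mono (copy-embeds u a lab≡a fsuc (λ _ → refl)) θ h)))
    where
      θ = δ A (st r u) a
      param-child : ChildLabelsᴺ (arᵖ a) (copy u) (fzero , ⌜ check v ⌝)
      param-child =
        let j≡ = trans (child-copy-+ u 0) (cong (λ a → spawn (inpos r u) a 0) lab≡a) in
          nk r u + 0
        , ≤-trans (+-monoʳ-< (nk r u) (subst (λ a → 0 < paramCount a) (sym lab≡a) (s≤s z≤n)))
                  (degree-copy-≥ u)
        , cong direction j≡ , cong (λ n → ⌜ roleAt n ⌝) j≡
  simulate-step u a@(inj₂ s) lab≡a h =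
    ⊨-mapᴾ⁺ (asSim (λ d → d)) θ (⊨-mono (copy-embeds u a lab≡a (λ d → d) (λ _ → refl)) θ h)
    where θ = δ A (st r u) a

  Spawns : Node → ℕ → List ℕ → Sym′ → Set
  Spawns n o p a = ∀ m → m < arᵖ a → o + m < degree n × child n (o + m) ≡ spawn p a m

  spawned-label : ∀ n o p a → Spawns n o p a → ∀ m → m < arᵖ a →
                  (d : Fin (arᵖ a)) → direction (spawn p a m) ≡ toℕ d →
                  ChildLabelsᴺ (arᵖ a) n (d , ⌜ roleAt (spawn p a m) ⌝)
  spawned-label n o p a spawned m m< d dm =
    let o+m< , j≡ = spawned m m< in
    o + m , o+m< , trans (cong direction j≡) dm , cong (λ n → ⌜ roleAt n ⌝) j≡

  shape-step : ∀ n o p a → Spawns n o p a → ChildLabelsᴺ (arᵖ a) n ⊨ δShape (symP E a)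
  shape-step n o p a@(inj₁ (σ , v , e)) spawned =
    ⊨-⋁⁺ (nV E) _ v (⊨-withParam⁺ v _ e (spawned-label n o p a spawned 0 (s≤s z≤n) fzero refl)
      (⊨-⋀⁺ (arity E σ) _ λ i →
         spawned-label n o p a spawned (suc (toℕ i)) (s≤s (toℕ<n i)) (fsuc i) refl))
  shape-step n o p a@(inj₂ s) spawned =
    ⊨-⋀⁺ (arS E s) _ λ i → spawned-label n o p a spawned (toℕ i) (toℕ<n i) i refl

  copy-transition : ∀ u → RNode r u →
                    ChildLabelsᴺ (arᵖ (lab u)) (copy u) ⊨ δRole (roleAt (copy u)) (symP E (lab u))
  copy-transition [] _ =
      subst (λ q → ChildLabelsᴺ _ (copy []) ⊨ δSim q (symP E (lab []))) (proj₁ R)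
        (simulate-step [] (lab []) refl (proj₂ (proj₂ R [] tt)))
    , shape-step (copy []) (nk r []) [] (lab [])
        (λ m m< → +-monoʳ-< (nk r []) m< , child-copy-+ [] m)
  copy-transition (j ∷ u) ru =
    simulate-step (j ∷ u) (lab (j ∷ u)) refl (proj₂ (proj₂ R (j ∷ u) ru))

  node-step : ∀ n → Valid n → RunStepᴺ n (toP E t (position n))
  node-step (copy u) ru =
    subst (RunStepᴺ (copy u)) (sym (toP-posP t (inpos r u)))
      (copy-directions u ru , copy-transition u ru)
  node-step (shapeAt p d) _ =
    subst (RunStepᴺ (shapeAt p d)) (sym (toP-posP t p))
      (spawn-direction< p (t p) , shape-step (shapeAt p d) 0 p (t p) (λ m m< → m< , refl))
  node-step (checkAt P v) P≡v =
    subst (RunStepᴺ (checkAt P v)) (sym P≡v) ((λ _ ()) , ⊨-δCheck-self v _)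

  isRun : IsRun Ap (toP E t) run
  isRun = refl , λ u ru →
    let valid , u≡ = node-valid u ru
        directions , transition = node-step (node u) valid
    in subst (RunStep Ap run u) (cong (toP E t) (sym u≡))
         ( directions
         , subst (ChildLabelsᴺ _ (node u) ⊨_) (sym (δ-⌜⌝ (roleAt (node u)) _)) transition)

  parameter-check-degree : ∀ p a m → m < paramCount a → degree (spawn p a m) ≡ 0
  parameter-check-degree p (inj₁ _) zero    _              = refl
  parameter-check-degree p (inj₁ _) (suc _) (s≤s ())

  -- Shape checking is spawned only at the root and parameter checks are leaves, so an
  -- infinite path either stays in the copy of r or leaves it at its first step; which one
  -- is decided by π 0, so no case split on an infinite sequence is needed.
  module _ (π : ℕ → ℕ) (path : IsPath run π) where

    follows-r : π 0 < nk r [] → ∀ n → node (addr run π n) ≡ copy (addr run π n) →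
                π n < nk r (addr run π n)
    follows-r π0< zero    _       = π0<
    follows-r π0< (suc n) is-copy with π (suc n) <? nk r (addr run π (suc n))
    ... | yes π< = π<
    ... | no π≮  = ⊥-elim (n≮0 (subst (π (suc (suc n)) <_) degree≡0 (path (suc (suc n)))))
      where
        u = addr run π (suc n)
        idx< : π (suc n) ∸ nk r u < paramCount (lab u)
        idx< = ∸-<-spawned u (subst (λ m → π (suc n) < degree m) is-copy (path (suc n))) π≮
        degree≡0 : degree (node (addr run π (suc (suc n)))) ≡ 0
        degree≡0 = trans (cong (λ m → degree (child m (π (suc n)))) is-copy)
                     (trans (cong degree (child-copy-≮ u _ π≮)) (parameter-check-degree _ _ _ idx<))

    stays-in-copy : π 0 < nk r [] → ∀ n →
                    node (addr run π n) ≡ copy (addr run π n) × RNode r (addr run π n)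
    stays-in-copy π0< zero    = refl , tt
    stays-in-copy π0< (suc n) =
      let is-copy , rn = stays-in-copy π0< n
          π< = follows-r π0< n is-copy
      in trans (cong (λ m → child m (π n)) is-copy) (child-copy-< _ (π n) π<) , rn , π<

    path-of-r : π 0 < nk r [] → IsPath r π
    path-of-r π0< n = subst (λ u → π n < nk r u) (addr-irrelevant run r π n)
                        (follows-r π0< n (proj₁ (stays-in-copy π0< n)))

    priorities-of-r : π 0 < nk r [] →
                      (λ n → Ω A (st r (addr r π n))) ≗ (λ n → Ω Ap (st run (addr run π n)))
    priorities-of-r π0< zero    = trans (cong (Ω A) (proj₁ R)) (sym (Ω-⌜⌝ start))
    priorities-of-r π0< (suc n) =
      trans (cong (λ u → Ω A (st r u)) (addr-irrelevant r run π (suc n)))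
        (trans (sym (Ω-⌜⌝ (simulate _)))
          (cong (λ m → Ω Ap ⌜ roleAt m ⌝) (sym (proj₁ (stays-in-copy π0< (suc n))))))

    spawned-shape : ∀ n p a m → node (addr run π (suc n)) ≡ spawn p a m →
                    ∃[ p′ ] ∃[ d ] node (addr run π (suc n)) ≡ shapeAt p′ d
    spawned-shape n p (inj₁ _) zero    eq =
      ⊥-elim (n≮0 (subst (π (suc n) <_) (cong degree eq) (path (suc n))))
    spawned-shape n p (inj₁ _) (suc i) eq = _ , _ , eq
    spawned-shape n p (inj₂ _) i       eq = _ , _ , eq

    stays-in-shape : ¬ π 0 < nk r [] → ∀ n → ∃[ p ] ∃[ d ] node (addr run π (suc n)) ≡ shapeAt p d
    stays-in-shape π0≮ zero    = spawned-shape 0 [] (lab []) _ (child-copy-≮ [] (π 0) π0≮)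
    stays-in-shape π0≮ (suc n) =
      let p , d , eq = stays-in-shape π0≮ n in
      spawned-shape (suc n) p (t p) (π (suc n)) (cong (λ m → child m (π (suc n))) eq)

    shape-priorities : ¬ π 0 < nk r [] → ∀ n → Ω Ap (st run (addr run π (suc n))) ≡ 0
    shape-priorities π0≮ n =
      let _ , _ , eq = stays-in-shape π0≮ n in
      trans (cong (λ m → Ω Ap ⌜ roleAt m ⌝) eq) (Ω-⌜⌝ shape)

  accepting : IsAccepting Ap (toP E t) run
  accepting π path with π 0 <? nk r []
  ... | yes π0< = Parity-resp-≗ (priorities-of-r π path π0<) (acc π (path-of-r π path π0<))
  ... | no π0≮  = Parity-tail-zero (shape-priorities π path π0≮)

  accepts : Accepts Ap (toP E t)
  accepts = run , isRun , accepting

module Soundness (E : EffectSignature) (A : APT (Σ′ E)) (s : Tree (Σp E))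
                 (r : RunData (nQ (Construction.Ap E A))) (R : IsRun (Construction.Ap E A) s r)
                 (acc : IsAccepting (Construction.Ap E A) s r) where
  open Encoding E
  open Construction E A

  lab : List ℕ → Symᵖ
  lab u = s (inpos r u)

  transition : ∀ u → RNode r u → ∀ ρ → role (st r u) ≡ ρ →
               ChildLabelsⁿ (ar (Σp E) (lab u)) r u ⊨ δRole ρ (lab u)
  transition u ru ρ ≡ρ = subst (λ ρ → _ ⊨ δRole ρ (lab u)) ≡ρ (proj₂ (proj₂ R u ru))

  root-start : role (st r []) ≡ start
  root-start = trans (cong role (proj₁ R)) (role-⌜⌝ start)

  label-role : ∀ {u j} ρ → st r (j ∷ u) ≡ ⌜ ρ ⌝ → role (st r (j ∷ u)) ≡ ρ
  label-role ρ eq = trans (cong role eq) (role-⌜⌝ ρ)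

  shaped-symbol : ∀ f (Y : Lab f → Set) → Y ⊨ δShape f → Sym′
  shaped-symbol (inj₁ σ)        Y h =
    let v , e , _ = ⊨-⋁withParam⁻ _ h in inj₁ (σ , v , e)
  shaped-symbol (inj₂ (inj₂ s)) Y h = inj₂ s

  open Decode (shaped-symbol (lab []) _ (proj₂ (transition [] tt start root-start)))

  t : Tree (Σ′ E)
  t p = decode (s (posS s p)) (s (posS s p ++ [ 0 ]))

  ShapeChecked : List ℕ → Set
  ShapeChecked u = RNode r u × (role (st r u) ≡ start ⊎ role (st r u) ≡ shape)

  shape-transition : ∀ u → ShapeChecked u → ChildLabelsⁿ (ar (Σp E) (lab u)) r u ⊨ δShape (lab u)
  shape-transition u (ru , inj₁ ≡start) = proj₂ (transition u ru start ≡start)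
  shape-transition u (ru , inj₂ ≡shape) = transition u ru shape ≡shape

  check-child : ∀ u → RNode r u → ∀ j → j < nk r u → ∀ v → dir r (j ∷ u) ≡ 0 →
                st r (j ∷ u) ≡ ⌜ check v ⌝ → s (inpos r u ++ [ 0 ]) ≡ inj₂ (inj₁ v)
  check-child u ru j j< v dj sj =
    subst (λ d → s (inpos r u ++ [ d ]) ≡ inj₂ (inj₁ v)) dj
      (⊨-δCheck⁻ v _ _ (transition (j ∷ u) (ru , j<) (check v) (label-role (check v) sj)))

  shape-WellShaped : ∀ u → RNode r u → ∀ f → ChildLabelsⁿ (ar (Σp E) f) r u ⊨ δShape f →
                     WellShaped f (s (inpos r u ++ [ 0 ]))
  shape-WellShaped u ru (inj₁ σ) h =
    let v , e , (j , j< , dj , sj) , _ = ⊨-⋁withParam⁻ _ h in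
    v , e , check-child u ru j j< v dj sj
  shape-WellShaped u ru (inj₂ (inj₂ _)) h = tt

  shape-child : ∀ u f → ChildLabelsⁿ (ar (Σp E) f) r u ⊨ δShape f → ∀ d → d < arityᵖ f →
                ∃[ j ] (j < nk r u × dir r (j ∷ u) ≡ shiftᵖ f d × st r (j ∷ u) ≡ ⌜ shape ⌝)
  shape-child u (inj₁ σ) h d d< =
    let _ , _ , _ , children = ⊨-⋁withParam⁻ _ h
        j , j< , dj , sj = ⊨-⋀⁻ (arity E σ) _ children (fromℕ< d<)
    in j , j< , trans dj (cong suc (toℕ-fromℕ< d<)) , sj
  shape-child u (inj₂ (inj₂ s₀)) h d d< =
    let j , j< , dj , sj = ⊨-⋀⁻ (arS E s₀) _ h (fromℕ< d<) in
    j , j< , trans dj (toℕ-fromℕ< d<) , sj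

  Covered : List ℕ → Set
  Covered p = ∃[ u ] (ShapeChecked u × inpos r u ≡ posS s p)

  arityᵖ-covered : ∀ p d u → ShapeChecked u → inpos r u ≡ posS s p →
                   ValidPos {Σ′ E} t (p ++ [ d ]) → d < arityᵖ (lab u)
  arityᵖ-covered p d u checked@(ru , _) u≡p vp =
    subst (d <_) (ar-decode (lab u) _ (shape-WellShaped u ru (lab u) (shape-transition u checked)))
      (subst (λ P → d < ar (Σ′ E) (decode (s P) (s (P ++ [ 0 ])))) (sym u≡p)
        (proj₂ (ValidPos-++[]⁻ t p d vp)))

  Covered-++[] : ∀ p d → ValidPos {Σ′ E} t (p ++ [ d ]) → Covered p → Covered (p ++ [ d ])
  Covered-++[] p d vp (u , checked@(ru , _) , u≡p)
    with j , j< , dj , sj ← shape-child u (lab u) (shape-transition u checked) d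
                              (arityᵖ-covered p d u checked u≡p vp) =
      (j ∷ u) , ((ru , j<) , inj₂ (label-role shape sj))
    , trans (cong (λ d′ → inpos r u ++ [ d′ ]) dj)
        (trans (cong (λ P → P ++ [ shiftᵖ (s P) d ]) u≡p) (sym (posS-++[] s p d)))

  Covered-++ : ∀ q p → ValidPos {Σ′ E} t (p ++ q) → Covered p → Covered (p ++ q)
  Covered-++ []      p _  c = subst Covered (sym (++-identityʳ p)) c
  Covered-++ (d ∷ q) p vp c =
    subst Covered (++-assoc p [ d ] q)
      (Covered-++ q (p ++ [ d ]) vp′ (Covered-++[] p d (ValidPos-++⁻ˡ t (p ++ [ d ]) q vp′) c))
    where
      vp′ : ValidPos {Σ′ E} t ((p ++ [ d ]) ++ q)
      vp′ = subst (ValidPos {Σ′ E} t) (sym (++-assoc p [ d ] q)) vp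

  covered : ∀ p → ValidPos {Σ′ E} t p → Covered p
  covered p vp = Covered-++ p [] vp ([] , (tt , inj₁ root-start) , refl)

  WellShaped-at : ∀ p → ValidPos {Σ′ E} t p → WellShaped (s (posS s p)) (s (posS s p ++ [ 0 ]))
  WellShaped-at p vp =
    let u , checked@(ru , _) , u≡p = covered p vp in
    subst (λ P → WellShaped (s P) (s (P ++ [ 0 ]))) u≡p
      (shape-WellShaped u ru (lab u) (shape-transition u checked))

  toP-t≈s : _≈_ {Σp E} (toP E t) s
  toP-t≈s = toP-≈ t s λ p vp → decode-Encodes _ _ (WellShaped-at p vp)

  simulating-child? : ∀ u j → Dec (Simulating (role (st r (j ∷ u))))
  simulating-child? u j = simulating? (role (st r (j ∷ u)))

  simKids : List ℕ → List ℕ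
  simKids u = filter (simulating-child? u) (upTo (nk r u))

  simKid-sound : ∀ u i → i < length (simKids u) →
                 nth (simKids u) i < nk r u × Simulating (role (st r (nth (simKids u) i ∷ u)))
  simKid-sound u i i< =
    let ∈upTo , sim = ∈-filter⁻ (simulating-child? u) (nth-∈ _ i i<) in ∈-upTo⁻ ∈upTo , sim

  simKid-complete : ∀ u j → j < nk r u → Simulating (role (st r (j ∷ u))) →
                    ∃[ i ] (i < length (simKids u) × nth (simKids u) i ≡ j)
  simKid-complete u j j< sim = ∈⇒nth (∈-filter⁺ (simulating-child? u) (∈-upTo⁺ j<) sim)

  origin : List ℕ → List ℕ
  origin []       = []
  origin (i ∷ u′) = nth (simKids (origin u′)) i ∷ origin u′

  extractedDir : List ℕ → ℕ
  extractedDir []       = 0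
  extractedDir (i ∷ u′) = unshift (lab (origin u′)) (dir r (origin (i ∷ u′)))

  -- The run of A on t: the part of r in simulating states, node u′ coming from node origin u′.
  r′ : RunData (nQ A)
  r′ = record { nk  = λ u′ → length (simKids (origin u′))
              ; dir = extractedDir
              ; st  = λ u′ → simState (role (st r (origin u′))) }

  simulating-not-param : ∀ w j v → RNode r (j ∷ w) → Simulating (role (st r (j ∷ w))) →
                         s (inpos r w ++ [ 0 ]) ≡ inj₂ (inj₁ v) → dir r (j ∷ w) ≢ 0
  simulating-not-param w j v rn sim param≡v d≡0 =
    δRole⇒δSim _ sim (inj₂ (inj₁ v)) _
      (subst (λ f → ChildLabelsⁿ (ar (Σp E) f) r (j ∷ w) ⊨ δRole (role (st r (j ∷ w))) f)
        (trans (cong (λ d → s (inpos r w ++ [ d ])) d≡0) param≡v)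
        (transition (j ∷ w) rn _ refl))

  pullback : ∀ u′ f → lab (origin u′) ≡ f → {k k′ : ℕ} (ι : Fin k → Fin k′) →
             (∀ d → unshift f (toℕ (ι d)) ≡ toℕ d) →
             ∀ x → ChildLabelsⁿ k′ r (origin u′) (asSim ι x) → ChildLabelsⁿ k r′ u′ x
  pullback u′ f lab≡f ι unshift-ι (d , q) (j , j< , dj , sj)
    with i , i< , i≡j ← simKid-complete (origin u′) j j<
                           (subst Simulating (sym (label-role (simulate q) sj)) tt) =
      i , i<
    , trans (cong₂ (λ g j → unshift g (dir r (j ∷ origin u′))) lab≡f i≡j)
        (trans (cong (unshift f) dj) (unshift-ι d))
    , trans (cong (λ j → simState (role (st r (j ∷ origin u′)))) i≡j)
        (cong simState (label-role (simulate q) sj))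

  parameter-≡ : ∀ σ {v v′} (e : ty E v ≡ param E σ) (e′ : ty E v′ ≡ param E σ) → v ≡ v′ →
                _≡_ {A = Σ[ v ∈ Fin (nV E) ] ty E v ≡ param E σ} (v , e) (v′ , e′)
  parameter-≡ σ e e′ refl = cong (_ ,_) (≡-irrelevant e e′)

  leaf-injective : ∀ {v v′ : Fin (nV E)} → _≡_ {A = Symᵖ} (inj₂ (inj₁ v)) (inj₂ (inj₁ v′)) → v ≡ v′
  leaf-injective refl = refl

  op-step : ∀ u′ σ v (e : ty E v ≡ param E σ) → lab (origin u′) ≡ inj₁ σ →
            s (inpos r (origin u′) ++ [ 0 ]) ≡ inj₂ (inj₁ v) → RNode r (origin u′) →
            Simulating (role (st r (origin u′))) →
            RunStep Ap r (origin u′) (inj₁ σ) → RunStep A r′ u′ (inj₁ (σ , v , e))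
  op-step u′ σ v e lab≡σ param≡v rn sim (directions , transition)
    with v′ , e′ , (j , j< , dj , sj) , θ
           ← ⊨-⋁withParam⁻ _ (δRole⇒δSim _ sim (inj₁ σ) _ transition) =
      (λ i i< → let j< , simⱼ = simKid-sound w i i< in
        subst (λ f → unshift f (dir r (nth (simKids w) i ∷ w)) < arity E σ) (sym lab≡σ)
          (pred-< (directions _ j<) (simulating-not-param w _ v (rn , j<) simⱼ param≡v)))
    , ⊨-mono (pullback u′ (inj₁ σ) lab≡σ fsuc (λ _ → refl)) θσ
        (⊨-mapᴾ⁻ (asSim fsuc) θσ
          (subst (λ ve → ChildLabelsⁿ (suc (arity E σ)) r w
                           ⊨ mapᴾ (asSim fsuc) (δ A (st r′ u′) (inj₁ (σ , ve))))
            (parameter-≡ σ e′ e v′≡v) θ))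
    where
      w = origin u′
      θσ = δ A (st r′ u′) (inj₁ (σ , v , e))
      v′≡v = leaf-injective (trans (sym (check-child w rn j j< v′ dj sj)) param≡v)

  other-step : ∀ u′ s₀ → lab (origin u′) ≡ inj₂ (inj₂ s₀) →
               Simulating (role (st r (origin u′))) →
               RunStep Ap r (origin u′) (inj₂ (inj₂ s₀)) → RunStep A r′ u′ (inj₂ s₀)
  other-step u′ s₀ lab≡s₀ sim (directions , transition) =
      (λ i i< → subst (λ f → unshift f (dir r (nth (simKids w) i ∷ w)) < arS E s₀) (sym lab≡s₀)
                  (directions _ (proj₁ (simKid-sound w i i<))))
    , ⊨-mono (pullback u′ _ lab≡s₀ (λ d → d) (λ _ → refl)) θ
        (⊨-mapᴾ⁻ (asSim (λ d → d)) θ (δRole⇒δSim _ sim (inj₂ (inj₂ s₀)) _ transition))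
    where
      w = origin u′
      θ = δ A (st r′ u′) (inj₂ s₀)

  decoded-step : ∀ u′ f g → WellShaped f g →
                 lab (origin u′) ≡ f → s (inpos r (origin u′) ++ [ 0 ]) ≡ g →
                 RNode r (origin u′) → Simulating (role (st r (origin u′))) →
                 RunStep A r′ u′ (decode f g)
  decoded-step u′ (inj₁ σ) _ (v , e , refl) lab≡f param≡g rn sim with fits? v σ
  ... | yes e′ =
    op-step u′ σ v e′ lab≡f param≡g rn sim (subst (RunStep Ap r (origin u′)) lab≡f (proj₂ R _ rn))
  ... | no ¬e  = ⊥-elim (¬e e)
  decoded-step u′ (inj₂ (inj₂ s₀)) _ tt lab≡f param≡g rn sim =
    other-step u′ s₀ lab≡f sim (subst (RunStep Ap r (origin u′)) lab≡f (proj₂ R _ rn))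

  record Tracks (u′ : List ℕ) : Set where
    field
      rnode      : RNode r (origin u′)
      aligned    : inpos r (origin u′) ≡ posS s (inpos r′ u′)
      simulating : Simulating (role (st r (origin u′)))
      valid      : ValidPos {Σ′ E} t (inpos r′ u′)
  open Tracks

  extracted-step : ∀ u′ → Tracks u′ → RunStep A r′ u′ (t (inpos r′ u′))
  extracted-step u′ T =
    subst (λ P → RunStep A r′ u′ (decode (s P) (s (P ++ [ 0 ])))) (aligned T)
      (decoded-step u′ _ _ shaped refl refl (rnode T) (simulating T))
    where
      shaped = subst (λ P → WellShaped (s P) (s (P ++ [ 0 ]))) (sym (aligned T))
                 (WellShaped-at (inpos r′ u′) (valid T))

  tracks : ∀ u′ → RNode r′ u′ → Tracks u′
  tracks []       _          = record
    { rnode = tt ; aligned = refl ; simulating = subst Simulating (sym root-start) tt ; valid = tt }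
  tracks (i ∷ u′) (ru′ , i<) = record
    { rnode      = rnode T , j<
    ; aligned    =
        trans (cong (λ d → inpos r w ++ [ d ])
                (sym (shiftᵖ-unshift (lab w) _ shaped (dir r (j ∷ w))
                       (λ v param≡v → simulating-not-param w j v (rnode T , j<) simⱼ param≡v))))
          (trans (cong (λ P → P ++ [ shiftᵖ (s P) (extractedDir (i ∷ u′)) ]) (aligned T))
            (sym (posS-++[] s (inpos r′ u′) _)))
    ; simulating = simⱼ
    ; valid      = ValidPos-++[] t (inpos r′ u′) _ (valid T) (proj₁ (extracted-step u′ T) i i<)
    }
    where
      T = tracks u′ ru′
      w = origin u′
      j = nth (simKids w) i
      j< = proj₁ (simKid-sound w i i<)
      simⱼ = proj₂ (simKid-sound w i i<)
      shaped = subst (λ P → WellShaped (s P) (s (P ++ [ 0 ]))) (sym (aligned T))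
                 (WellShaped-at (inpos r′ u′) (valid T))

  isRun′ : IsRun A t r′
  isRun′ = cong simState root-start , λ u′ ru′ → extracted-step u′ (tracks u′ ru′)

  accepting′ : IsAccepting A t r′
  accepting′ π′ path′ = Parity-resp-≗ priorities (acc π path)
    where
      π : ℕ → ℕ
      π n = nth (simKids (origin (addr r′ π′ n))) (π′ n)

      origin-addr : ∀ n → origin (addr r′ π′ n) ≡ addr r π n
      origin-addr zero    = refl
      origin-addr (suc n) = cong (π n ∷_) (origin-addr n)

      path : IsPath r π
      path n = subst (λ u → π n < nk r u) (origin-addr n) (proj₁ (simKid-sound _ (π′ n) (path′ n)))

      priorities : (λ n → Ω Ap (st r (addr r π n))) ≗ (λ n → Ω A (st r′ (addr r′ π′ n)))
      priorities n = trans (cong (λ u → Ω Ap (st r u)) (sym (origin-addr n)))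
                       (ΩRole-simulating _ (simulating (tracks _ (IsPath⇒RNode r′ π′ path′ n))))

  preimage : ∃[ t′ ] (Accepts A t′ × _≈_ {Σp E} (toP E t′) s)
  preimage = t , (r′ , isRun′ , accepting′) , toP-t≈s

proposition6p5 : (E : EffectSignature) (A : APT (Σ′ E)) →
    Σ[ Ap ∈ APT (Σp E) ] ∀ (s : Tree (Σp E)) →
      (Accepts Ap s → ∃[ t ] (Accepts A t × _≈_ {Σp E} (toP E t) s))
      × (∃[ t ] (Accepts A t × _≈_ {Σp E} (toP E t) s) → Accepts Ap s)
proposition6p5 E A = Construction.Ap E A , λ s →
    (λ { (r , R , acc) → Soundness.preimage E A s r R acc })
  , (λ { (t , (r , R , acc) , toP-t≈s) →
         Accepts-resp-≈ (Construction.Ap E A) (toP E t) s toP-t≈s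
           (Completeness.accepts E A t r R acc) })
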